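{- Fix $n\in\mathbb{N}$. Then \[\{I(2,n,w): w\in S_n\}=\{2^{n-2}m : m\in\{0,1,2,\dots,2^n-1-n\}\}.\] In particular, the set of possible values of $I(2,n,w)$ is an arithmetic progression with step $2^{n-2}$.
   Context: The infinite rooted directed binary tree has a root on layer $1$; every vertex has a left and a right child on the next layer. A vertex with at least $2$ chips may fire by choosing two of its labeled chips and sending the smaller to its left child and the larger to its right child. Chips $0,\dots,2^n-1$ start at the root and are written in $n$-digit binary expansion. For $w\in S_n$, the strategy $F_w$ fires, for each $i\in[n]$, each vertex $v$ on layer $i$ so that chips on $v$ whose $w_i$th most significant bit is $0$ go to the left child and those whose $w_i$th most significant bit is $1$ go to the right child. $\mathcal{C}_{2,n,w}$ is the resulting stable configuration, read as the sequence of chips on layer $n+1$ from left to right, and $I(2,n,w)$ is its number of inversions. -}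

module Defs where

open import Data.Nat using (ℕ; zero; suc; _+_; _∸_; _/_; _%_; _<ᵇ_; _≡ᵇ_)
open import Data.Bool using (Bool; true; false; not)
open import Data.List using (List; []; _∷_; _++_; filterᵇ; length; map; upTo; allFin)
open import Data.Fin using (Fin; toℕ)
open import Data.Fin.Permutation using (Permutation′; _⟨$⟩ʳ_)
open import Data.Nat using (_^_)

lsbit : ℕ → ℕ → Bool
lsbit zero    c = c % 2 ≡ᵇ 1
lsbit (suc j) c = lsbit j (c / 2)

-- the (k+1)-th most significant bit of the n-digit binary expansion of c,
-- for k : Fin n (k = 0 is the most significant digit)
msbit : (n : ℕ) → Fin n → ℕ → Bool
msbit n k c = lsbit (n ∸ suc (toℕ k)) c

-- Firing a vertex holding chips cs according to the remaining list of
-- digit positions ks (positions used on this layer and the layers below).  The result is the list of chips at the bottom layer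
-- of this subtree, read from left to right.
fireDown : (n : ℕ) → List (Fin n) → List ℕ → List ℕ
fireDown n []       cs = cs
fireDown n (k ∷ ks) cs =
  fireDown n ks (filterᵇ (λ c → not (msbit n k c)) cs)
  ++ fireDown n ks (filterᵇ (λ c → msbit n k c) cs)

-- the sequence w_1, ..., w_n (as 0-indexed digit positions)
wSeq : (n : ℕ) → Permutation′ n → List (Fin n)
wSeq n w = map (w ⟨$⟩ʳ_) (allFin n)

-- C_{2,n,w}: chips 0 .. 2^n - 1 start at the root; chips on layer n+1, left to right
config : (n : ℕ) → Permutation′ n → List ℕ
config n w = fireDown n (wSeq n w) (upTo (2 ^ n))

inversions : List ℕ → ℕ
inversions []       = 0
inversions (x ∷ xs) = length (filterᵇ (λ y → y <ᵇ x) xs) + inversions xs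

I₂ : (n : ℕ) → Permutation′ n → ℕ
I₂ n w = inversions (config n w)

{-# OPTIONS --safe #-}
module Submission where

-- Let the root read digit e (counted from the least significant one).  It sends the chips
-- 0, …, 2^(N+1) - 1 whose digit e is 0 to the left and the others to the right, and deleting
-- digit e identifies each half, order-preservingly, with 0, …, 2^N - 1, which the lower layers
-- fire according to w with its first entry removed (w′).  So the final configuration is
-- f₀(C) ++ f₁(C) for C = C_{2,N,w′} and the strictly increasing digit insertions f₀, f₁, and
-- I(2,N+1,w) = 2 I(2,N,w′) + #{(x, y) ∈ C × C : f₁ y < f₀ x}.  The last count does not depend
-- on the order of C, which is a permutation of 0, …, 2^N - 1; it equals 2^(N-1) (2^N - 2^e).
-- Hence I(2,n,w) = 2^(n-2) m where each layer adds 2^N - 2^e to m.  As e runs through 0, …, N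
-- these increments are spaced by 2^e ≤ 2^N - N, so the attainable m fill an interval.

open import Defs
open import Data.Bool using (Bool; true; false; not; if_then_else_; T; T?)
open import Data.Empty using (⊥-elim)
open import Data.Fin using (Fin; toℕ; fromℕ<; punchIn) renaming (zero to fzero; suc to fsuc)
open import Data.Fin.Properties using (toℕ<n; toℕ-fromℕ<)
open import Data.Fin.Permutation
  using (Permutation′; _⟨$⟩ʳ_; _≈_; remove; insert; remove-insert; punchIn-permute)
  renaming (id to idₚ)
open import Data.List
  using (List; []; _∷_; _++_; filterᵇ; length; map; upTo; applyUpTo; tabulate; allFin)
open import Data.List.Properties
  using (filter-++; filter-all; filter-none; filter-≐; length-++; length-map; length-upTo;
         map-++; map-∘; map-cong; map-cong-local; map-id-local; map-upTo; map-tabulate;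
         tabulate-cong; ++-identityʳ)
open import Data.List.Relation.Unary.All as All using (All; []; _∷_)
open import Data.List.Relation.Unary.All.Properties using (all-upTo) renaming (map⁺ to All-map⁺)
open import Data.List.Relation.Binary.Permutation.Propositional using (_↭_; ↭-refl; ↭-trans; prep)
open import Data.List.Relation.Binary.Permutation.Propositional.Properties
  using (map⁺; filter-↭; ↭-length; ++⁺; shift)
open import Data.Nat
open import Data.Nat.DivMod
  using ([m+kn]%n≡m%n; m<n⇒m%n≡m; +-distrib-/-∣ʳ; m<n⇒m/n≡0; m*n/n≡m; m≡m%n+[m/n]*n; m%n<n;
         m<n*o⇒m/o<n; /-monoˡ-≤)
open import Data.Nat.Divisibility using (m∣m*n)
open import Data.Nat.ListAction using (sum)
open import Data.Nat.ListAction.Properties using (sum-++; sum-↭)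
open import Data.Nat.Properties
open import Data.Nat.Tactic.RingSolver using (solve-∀)
open import Data.Product using (∃; _×_; _,_)
open import Data.Sum using (_⊎_; inj₁; inj₂)
open import Data.Unit using (tt)
open import Function using (_∘_; id; _⇔_; mk⇔; Equivalence)
open import Relation.Binary using (_Preserves_⟶_; tri<; tri≈; tri>)
open import Relation.Binary.PropositionalEquality
open import Relation.Nullary using (¬_; yes; no)

-- Binary digits

digit : Bool → ℕ
digit false = 0
digit true  = 1

digit<2 : ∀ b → digit b < 2
digit<2 false = s≤s z≤n
digit<2 true  = s≤s (s≤s z≤n)

pushBit : Bool → ℕ → ℕ
pushBit b x = digit b + 2 * x

pushBit-%2 : ∀ b x → pushBit b x % 2 ≡ digit b
pushBit-%2 b x = begin
  (digit b + 2 * x) % 2 ≡⟨ cong (λ y → (digit b + y) % 2) (*-comm 2 x) ⟩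
  (digit b + x * 2) % 2 ≡⟨ [m+kn]%n≡m%n (digit b) x 2 ⟩
  digit b % 2           ≡⟨ m<n⇒m%n≡m (digit<2 b) ⟩
  digit b               ∎
  where open ≡-Reasoning

pushBit-/2 : ∀ b x → pushBit b x / 2 ≡ x
pushBit-/2 b x = begin
  (digit b + 2 * x) / 2   ≡⟨ +-distrib-/-∣ʳ (digit b) (m∣m*n x) ⟩
  digit b / 2 + 2 * x / 2 ≡⟨ cong₂ _+_ (m<n⇒m/n≡0 (digit<2 b)) (cong (_/ 2) (*-comm 2 x)) ⟩
  x * 2 / 2               ≡⟨ m*n/n≡m x 2 ⟩
  x                       ∎
  where open ≡-Reasoning

lsbit-zero-pushBit : ∀ b x → lsbit 0 (pushBit b x) ≡ b
lsbit-zero-pushBit false x = cong (_≡ᵇ 1) (pushBit-%2 false x)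
lsbit-zero-pushBit true  x = cong (_≡ᵇ 1) (pushBit-%2 true x)

lsbit-suc-pushBit : ∀ j b x → lsbit (suc j) (pushBit b x) ≡ lsbit j x
lsbit-suc-pushBit j b x = cong (lsbit j) (pushBit-/2 b x)

pushBit-lsbit-/2 : ∀ c → pushBit (lsbit 0 c) (c / 2) ≡ c
pushBit-lsbit-/2 c with c % 2 | m≡m%n+[m/n]*n c 2 | m%n<n c 2
... | 0           | c≡ | _ = sym (trans c≡ (cong (0 +_) (*-comm (c / 2) 2)))
... | 1           | c≡ | _ = sym (trans c≡ (cong (1 +_) (*-comm (c / 2) 2)))
... | suc (suc _) | _  | s≤s (s≤s ())

pushBit-+ : ∀ b a x → pushBit b (a + x) ≡ 2 * a + pushBit b x
pushBit-+ b = arith (digit b)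
  where
  arith : ∀ d a x → d + 2 * (a + x) ≡ 2 * a + (d + 2 * x)
  arith = solve-∀

2*-+-pushBit : ∀ a c → 2 * a + c ≡ pushBit (lsbit 0 c) (a + c / 2)
2*-+-pushBit a c = begin
  2 * a + c                           ≡⟨ cong (2 * a +_) (sym (pushBit-lsbit-/2 c)) ⟩
  2 * a + pushBit (lsbit 0 c) (c / 2) ≡⟨ sym (pushBit-+ (lsbit 0 c) a (c / 2)) ⟩
  pushBit (lsbit 0 c) (a + c / 2)     ∎
  where open ≡-Reasoning

lsbit-2^+ : ∀ {e N} c → e < N → lsbit e (2 ^ N + c) ≡ lsbit e c
lsbit-2^+ {zero} {suc N} c _ =
  trans (cong (lsbit 0) (2*-+-pushBit (2 ^ N) c)) (lsbit-zero-pushBit (lsbit 0 c) (2 ^ N + c / 2))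
lsbit-2^+ {suc e} {suc N} c (s≤s e<N) = begin
  lsbit (suc e) (2 * 2 ^ N + c)
    ≡⟨ cong (lsbit (suc e)) (2*-+-pushBit (2 ^ N) c) ⟩
  lsbit (suc e) (pushBit (lsbit 0 c) (2 ^ N + c / 2))
    ≡⟨ lsbit-suc-pushBit e (lsbit 0 c) (2 ^ N + c / 2) ⟩
  lsbit e (2 ^ N + c / 2)
    ≡⟨ lsbit-2^+ (c / 2) e<N ⟩
  lsbit e (c / 2) ∎
  where open ≡-Reasoning

m<2n⇒m/2<n : ∀ {m n} → m < 2 * n → m / 2 < n
m<2n⇒m/2<n {m} {n} m<2n = m<n*o⇒m/o<n (subst (m <_) (*-comm 2 n) m<2n)

pushBit-< : ∀ a b {x y} → x < y → pushBit a x < pushBit b y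
pushBit-< a b {x} {y} x<y = begin-strict
  digit a + 2 * x <⟨ +-monoˡ-< (2 * x) (digit<2 a) ⟩
  2 + 2 * x       ≡⟨ sym (*-suc 2 x) ⟩
  2 * suc x       ≤⟨ *-monoʳ-≤ 2 x<y ⟩
  2 * y           ≤⟨ m≤n+m (2 * y) (digit b) ⟩
  digit b + 2 * y ∎
  where open ≤-Reasoning

insertBit : Bool → ℕ → ℕ → ℕ
insertBit b zero    x = pushBit b x
insertBit b (suc e) x = pushBit (lsbit 0 x) (insertBit b e (x / 2))

insertBit-suc-pushBit : ∀ b e a x → insertBit b (suc e) (pushBit a x) ≡ pushBit a (insertBit b e x)
insertBit-suc-pushBit b e a x =
  cong₂ (λ a′ x′ → pushBit a′ (insertBit b e x′)) (lsbit-zero-pushBit a x) (pushBit-/2 a x)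

lsbit-insertBit-here : ∀ b e x → lsbit e (insertBit b e x) ≡ b
lsbit-insertBit-here b zero    x = lsbit-zero-pushBit b x
lsbit-insertBit-here b (suc e) x =
  trans (lsbit-suc-pushBit e (lsbit 0 x) (insertBit b e (x / 2))) (lsbit-insertBit-here b e (x / 2))

lsbit-insertBit-below : ∀ b {j e} x → j < e → lsbit j (insertBit b e x) ≡ lsbit j x
lsbit-insertBit-below b {zero}  {suc e} x _ = lsbit-zero-pushBit (lsbit 0 x) (insertBit b e (x / 2))
lsbit-insertBit-below b {suc j} {suc e} x (s≤s j<e) =
  trans (lsbit-suc-pushBit j (lsbit 0 x) (insertBit b e (x / 2))) (lsbit-insertBit-below b (x / 2) j<e)

lsbit-insertBit-above : ∀ b {j e} x → e ≤ j → lsbit (suc j) (insertBit b e x) ≡ lsbit j x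
lsbit-insertBit-above b {j}     {zero}  x _ = lsbit-suc-pushBit j b x
lsbit-insertBit-above b {suc j} {suc e} x (s≤s e≤j) =
  trans (lsbit-suc-pushBit (suc j) (lsbit 0 x) (insertBit b e (x / 2)))
        (lsbit-insertBit-above b (x / 2) e≤j)

insertBit-<2^ : ∀ b e {x} → x < 2 ^ e → insertBit b e x ≡ digit b * 2 ^ e + x
insertBit-<2^ b zero    {suc x} (s≤s ())
insertBit-<2^ b zero    {zero}  _ = arith (digit b)
  where
  arith : ∀ d → d + 2 * 0 ≡ d * 1 + 0
  arith = solve-∀
insertBit-<2^ b (suc e) {x} x<2^e+1 = begin
  pushBit (lsbit 0 x) (insertBit b e (x / 2))
    ≡⟨ cong (pushBit (lsbit 0 x)) (insertBit-<2^ b e (m<2n⇒m/2<n x<2^e+1)) ⟩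
  pushBit (lsbit 0 x) (digit b * 2 ^ e + x / 2)
    ≡⟨ sym (2*-+-pushBit (digit b * 2 ^ e) x) ⟩
  2 * (digit b * 2 ^ e) + x
    ≡⟨ cong (_+ x) (arith (digit b) (2 ^ e)) ⟩
  digit b * (2 * 2 ^ e) + x ∎
  where
  open ≡-Reasoning
  arith : ∀ d p → 2 * (d * p) ≡ d * (2 * p)
  arith = solve-∀

insertBit-true-<2^ : ∀ e {x} → x < 2 ^ e → insertBit true e x ≡ 2 ^ e + x
insertBit-true-<2^ e x<2^e = trans (insertBit-<2^ true e x<2^e) (cong (_+ _) (*-identityˡ (2 ^ e)))

lsbit-<2^ : ∀ e {c} → c < 2 ^ e → lsbit e c ≡ false
lsbit-<2^ e {c} c<2^e =
  trans (cong (lsbit e) (sym (insertBit-<2^ false e c<2^e))) (lsbit-insertBit-here false e c)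

lsbit-2^+<2^ : ∀ e {c} → c < 2 ^ e → lsbit e (2 ^ e + c) ≡ true
lsbit-2^+<2^ e {c} c<2^e =
  trans (cong (lsbit e) (sym (insertBit-true-<2^ e c<2^e))) (lsbit-insertBit-here true e c)

insertBit-2^+ : ∀ b {e N} x → e ≤ N → insertBit b e (2 ^ N + x) ≡ 2 ^ suc N + insertBit b e x
insertBit-2^+ b {zero}  {N}     x _ = pushBit-+ b (2 ^ N) x
insertBit-2^+ b {suc e} {suc N} x (s≤s e≤N) = begin
  insertBit b (suc e) (2 * 2 ^ N + x)
    ≡⟨ cong (insertBit b (suc e)) (2*-+-pushBit (2 ^ N) x) ⟩
  insertBit b (suc e) (pushBit (lsbit 0 x) (2 ^ N + x / 2))
    ≡⟨ insertBit-suc-pushBit b e (lsbit 0 x) (2 ^ N + x / 2) ⟩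
  pushBit (lsbit 0 x) (insertBit b e (2 ^ N + x / 2))
    ≡⟨ cong (pushBit (lsbit 0 x)) (insertBit-2^+ b (x / 2) e≤N) ⟩
  pushBit (lsbit 0 x) (2 ^ suc N + insertBit b e (x / 2))
    ≡⟨ pushBit-+ (lsbit 0 x) (2 ^ suc N) (insertBit b e (x / 2)) ⟩
  2 ^ suc (suc N) + insertBit b (suc e) x ∎
  where open ≡-Reasoning

insertBit-mono-< : ∀ b e → insertBit b e Preserves _<_ ⟶ _<_
insertBit-mono-< b zero x<y = +-monoʳ-< (digit b) (*-monoʳ-< 2 x<y)
insertBit-mono-< b (suc e) {x} {y} x<y with m≤n⇒m<n∨m≡n (/-monoˡ-≤ 2 (<⇒≤ x<y))
... | inj₁ x/2<y/2 = pushBit-< (lsbit 0 x) (lsbit 0 y) (insertBit-mono-< b e x/2<y/2)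
... | inj₂ x/2≡y/2 =
  subst (λ z → pushBit (lsbit 0 x) (insertBit b e (x / 2)) < pushBit (lsbit 0 y) (insertBit b e z))
        x/2≡y/2 (+-monoˡ-< (2 * insertBit b e (x / 2)) last-digits)
  where
  last-digits : digit (lsbit 0 x) < digit (lsbit 0 y)
  last-digits = +-cancelʳ-< (2 * (x / 2)) _ _
    (subst₂ _<_ (sym (pushBit-lsbit-/2 x))
                (trans (sym (pushBit-lsbit-/2 y)) (cong (pushBit (lsbit 0 y)) (sym x/2≡y/2))) x<y)

insertBit<2^suc : ∀ b {e N x} → e ≤ N → x < 2 ^ N → insertBit b e x < 2 ^ suc N
insertBit<2^suc b {zero}                _         x<2^N = pushBit-< b false x<2^N
insertBit<2^suc b {suc e} {suc N} {x} (s≤s e≤N) x<2^N =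
  pushBit-< (lsbit 0 x) false (insertBit<2^suc b e≤N (m<2n⇒m/2<n x<2^N))

-- Chips with a prescribed digit

hasBit : Bool → ℕ → ℕ → Bool
hasBit b e c = if b then lsbit e c else not (lsbit e c)

T-hasBit : ∀ b e c → lsbit e c ≡ b → T (hasBit b e c)
T-hasBit false e c eq rewrite eq = tt
T-hasBit true  e c eq rewrite eq = tt

¬T-hasBit : ∀ b e c → lsbit e c ≡ not b → ¬ T (hasBit b e c)
¬T-hasBit false e c eq rewrite eq = λ ()
¬T-hasBit true  e c eq rewrite eq = λ ()

filterᵇ-map : ∀ {A B : Set} (p : B → Bool) (f : A → B) xs →
  filterᵇ p (map f xs) ≡ map f (filterᵇ (p ∘ f) xs)
filterᵇ-map p f []       = refl
filterᵇ-map p f (x ∷ xs) with p (f x)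
... | true  = cong (f x ∷_) (filterᵇ-map p f xs)
... | false = filterᵇ-map p f xs

filterᵇ-cong : ∀ {A : Set} {p q : A → Bool} → p ≗ q → filterᵇ p ≗ filterᵇ q
filterᵇ-cong {p = p} {q} p≗q =
  filter-≐ (T? ∘ p) (T? ∘ q) ((λ {x} → subst T (p≗q x)) , (λ {x} → subst T (sym (p≗q x))))

applyUpTo-+ : ∀ {A : Set} (f : ℕ → A) m n →
  applyUpTo f (m + n) ≡ applyUpTo f m ++ applyUpTo (f ∘ (m +_)) n
applyUpTo-+ f zero    n = refl
applyUpTo-+ f (suc m) n = cong (f 0 ∷_) (applyUpTo-+ (f ∘ suc) m n)

upTo-+ : ∀ m n → upTo (m + n) ≡ upTo m ++ map (m +_) (upTo n)
upTo-+ m n = trans (applyUpTo-+ id m n) (cong (upTo m ++_) (sym (map-upTo (m +_) n)))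

2^suc≡2^+2^ : ∀ n → 2 ^ suc n ≡ 2 ^ n + 2 ^ n
2^suc≡2^+2^ n = cong (2 ^ n +_) (+-identityʳ (2 ^ n))

upTo-2^suc : ∀ N → upTo (2 ^ suc N) ≡ upTo (2 ^ N) ++ map (2 ^ N +_) (upTo (2 ^ N))
upTo-2^suc N = trans (cong upTo (2^suc≡2^+2^ N)) (upTo-+ (2 ^ N) (2 ^ N))

map-insertBit-upTo-2^suc : ∀ b {e N} → e ≤ N →
  let f = insertBit b e; L = upTo (2 ^ N) in
  map f (upTo (2 ^ suc N)) ≡ map f L ++ map (2 ^ suc N +_) (map f L)
map-insertBit-upTo-2^suc b {e} {N} e≤N = begin
  map f (upTo (2 ^ suc N))
    ≡⟨ cong (map f) (upTo-2^suc N) ⟩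
  map f (L ++ map (2 ^ N +_) L)
    ≡⟨ map-++ f L (map (2 ^ N +_) L) ⟩
  map f L ++ map f (map (2 ^ N +_) L)
    ≡⟨ cong (map f L ++_) (sym (map-∘ L)) ⟩
  map f L ++ map (f ∘ (2 ^ N +_)) L
    ≡⟨ cong (map f L ++_) (map-cong (λ x → insertBit-2^+ b x e≤N) L) ⟩
  map f L ++ map ((2 ^ suc N +_) ∘ f) L
    ≡⟨ cong (map f L ++_) (map-∘ L) ⟩
  map f L ++ map (2 ^ suc N +_) (map f L) ∎
  where
  open ≡-Reasoning
  f : ℕ → ℕ
  f = insertBit b e
  L : List ℕ
  L = upTo (2 ^ N)

filter-hasBit-upTo-2^suc : ∀ b e →
  filterᵇ (hasBit b e) (upTo (2 ^ suc e)) ≡ map (insertBit b e) (upTo (2 ^ e))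
filter-hasBit-upTo-2^suc b e = begin
  filterᵇ (hasBit b e) (upTo (2 ^ suc e))
    ≡⟨ cong (filterᵇ (hasBit b e)) (upTo-2^suc e) ⟩
  filterᵇ (hasBit b e) (U ++ 2^e+U)
    ≡⟨ filter-++ (T? ∘ hasBit b e) U 2^e+U ⟩
  filterᵇ (hasBit b e) U ++ filterᵇ (hasBit b e) 2^e+U
    ≡⟨ halves b ⟩
  map (insertBit b e) U ∎
  where
  open ≡-Reasoning
  U 2^e+U : List ℕ
  U = upTo (2 ^ e)
  2^e+U = map (2 ^ e +_) U
  low : All (λ c → lsbit e c ≡ false) U
  low = All.map (lsbit-<2^ e) (all-upTo (2 ^ e))
  high : All (λ c → lsbit e c ≡ true) 2^e+U
  high = All-map⁺ (All.map (lsbit-2^+<2^ e) (all-upTo (2 ^ e)))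
  halves : ∀ b → filterᵇ (hasBit b e) U ++ filterᵇ (hasBit b e) 2^e+U ≡ map (insertBit b e) U
  halves false = begin
    filterᵇ (hasBit false e) U ++ filterᵇ (hasBit false e) 2^e+U
      ≡⟨ cong₂ _++_ (filter-all (T? ∘ hasBit false e) (All.map (λ {c} → T-hasBit false e c) low))
                    (filter-none (T? ∘ hasBit false e) (All.map (λ {c} → ¬T-hasBit false e c) high)) ⟩
    U ++ []
      ≡⟨ ++-identityʳ U ⟩
    U
      ≡⟨ sym (map-id-local (All.map (insertBit-<2^ false e) (all-upTo (2 ^ e)))) ⟩
    map (insertBit false e) U ∎
  halves true = begin
    filterᵇ (hasBit true e) U ++ filterᵇ (hasBit true e) 2^e+U
      ≡⟨ cong₂ _++_ (filter-none (T? ∘ hasBit true e) (All.map (λ {c} → ¬T-hasBit true e c) low))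
                    (filter-all (T? ∘ hasBit true e) (All.map (λ {c} → T-hasBit true e c) high)) ⟩
    2^e+U
      ≡⟨ map-cong-local (All.map (sym ∘ insertBit-true-<2^ e) (all-upTo (2 ^ e))) ⟩
    map (insertBit true e) U ∎

filter-hasBit-upTo : ∀ b {e N} → e ≤ N →
  filterᵇ (hasBit b e) (upTo (2 ^ suc N)) ≡ map (insertBit b e) (upTo (2 ^ N))
filter-hasBit-upTo b {e} = go ∘ ≤⇒≤′
  where
  open ≡-Reasoning
  p : ℕ → Bool
  p = hasBit b e
  go : ∀ {N} → e ≤′ N → filterᵇ p (upTo (2 ^ suc N)) ≡ map (insertBit b e) (upTo (2 ^ N))
  go ≤′-refl = filter-hasBit-upTo-2^suc b e
  go (≤′-step {N} e≤′N) = begin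
    filterᵇ p (upTo (2 ^ suc (suc N)))
      ≡⟨ cong (filterᵇ p) (upTo-2^suc (suc N)) ⟩
    filterᵇ p (V ++ map (P +_) V)
      ≡⟨ filter-++ (T? ∘ p) V (map (P +_) V) ⟩
    filterᵇ p V ++ filterᵇ p (map (P +_) V)
      ≡⟨ cong (filterᵇ p V ++_) (filterᵇ-map p (P +_) V) ⟩
    filterᵇ p V ++ map (P +_) (filterᵇ (p ∘ (P +_)) V)
      ≡⟨ cong (λ xs → filterᵇ p V ++ map (P +_) xs) (filterᵇ-cong p-shift V) ⟩
    filterᵇ p V ++ map (P +_) (filterᵇ p V)
      ≡⟨ cong (λ xs → xs ++ map (P +_) xs) (go e≤′N) ⟩
    map (insertBit b e) L ++ map (P +_) (map (insertBit b e) L)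
      ≡⟨ sym (map-insertBit-upTo-2^suc b (≤′⇒≤ e≤′N)) ⟩
    map (insertBit b e) V ∎
    where
    P : ℕ
    P = 2 ^ suc N
    V L : List ℕ
    V = upTo P
    L = upTo (2 ^ N)
    p-shift : p ∘ (P +_) ≗ p
    p-shift c = cong (λ x → if b then x else not x) (lsbit-2^+ c (s≤s (≤′⇒≤ e≤′N)))

-- Inversions

countBelow : ℕ → List ℕ → ℕ
countBelow x ys = length (filterᵇ (_<ᵇ x) ys)

inversionsBetween : List ℕ → List ℕ → ℕ
inversionsBetween xs ys = sum (map (λ x → countBelow x ys) xs)

mono-reflects-< : ∀ {f : ℕ → ℕ} → f Preserves _<_ ⟶ _<_ → ∀ {x y} → f x < f y → x < y
mono-reflects-< f-mono {x} {y} fx<fy with <-cmp x y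
... | tri< x<y _ _  = x<y
... | tri≈ _ refl _ = ⊥-elim (<-irrefl refl fx<fy)
... | tri> _ _ y<x  = ⊥-elim (<-asym fx<fy (f-mono y<x))

countBelow-++ : ∀ x ys zs → countBelow x (ys ++ zs) ≡ countBelow x ys + countBelow x zs
countBelow-++ x ys zs =
  trans (cong length (filter-++ (T? ∘ (_<ᵇ x)) ys zs)) (length-++ (filterᵇ (_<ᵇ x) ys))

countBelow-↭ : ∀ x {ys zs} → ys ↭ zs → countBelow x ys ≡ countBelow x zs
countBelow-↭ x ys↭zs = ↭-length (filter-↭ (T? ∘ (_<ᵇ x)) ys↭zs)

countBelow-map : ∀ {f : ℕ → ℕ} → f Preserves _<_ ⟶ _<_ →
  ∀ x ys → countBelow (f x) (map f ys) ≡ countBelow x ys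
countBelow-map {f} f-mono x ys = begin
  length (filterᵇ (_<ᵇ f x) (map f ys))
    ≡⟨ cong length (filterᵇ-map (_<ᵇ f x) f ys) ⟩
  length (map f (filterᵇ ((_<ᵇ f x) ∘ f) ys))
    ≡⟨ length-map f (filterᵇ ((_<ᵇ f x) ∘ f) ys) ⟩
  length (filterᵇ ((_<ᵇ f x) ∘ f) ys)
    ≡⟨ cong length (filter-≐ (T? ∘ ((_<ᵇ f x) ∘ f)) (T? ∘ (_<ᵇ x)) (reflect , preserve) ys) ⟩
  countBelow x ys ∎
  where
  open ≡-Reasoning
  reflect : ∀ {y} → T (f y <ᵇ f x) → T (y <ᵇ x)
  reflect t = <⇒<ᵇ (mono-reflects-< f-mono (<ᵇ⇒< _ _ t))
  preserve : ∀ {y} → T (y <ᵇ x) → T (f y <ᵇ f x)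
  preserve t = <⇒<ᵇ (f-mono (<ᵇ⇒< _ _ t))

countBelow-≤ : ∀ {x ys} → All (x ≤_) ys → countBelow x ys ≡ 0
countBelow-≤ {x} x≤ys =
  cong length (filter-none (T? ∘ (_<ᵇ x)) (All.map (λ x≤y t → <⇒≱ (<ᵇ⇒< _ _ t) x≤y) x≤ys))

countBelow-> : ∀ {x ys} → All (_< x) ys → countBelow x ys ≡ length ys
countBelow-> {x} ys<x = cong length (filter-all (T? ∘ (_<ᵇ x)) (All.map <⇒<ᵇ ys<x))

inversions-++ : ∀ xs ys →
  inversions (xs ++ ys) ≡ inversions xs + inversions ys + inversionsBetween xs ys
inversions-++ []       ys = sym (+-identityʳ (inversions ys))
inversions-++ (x ∷ xs) ys = begin
  countBelow x (xs ++ ys) + inversions (xs ++ ys)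
    ≡⟨ cong₂ _+_ (countBelow-++ x xs ys) (inversions-++ xs ys) ⟩
  (countBelow x xs + countBelow x ys) + (inversions xs + inversions ys + inversionsBetween xs ys)
    ≡⟨ arith (countBelow x xs) (countBelow x ys) (inversions xs) (inversions ys)
             (inversionsBetween xs ys) ⟩
  countBelow x xs + inversions xs + inversions ys + (countBelow x ys + inversionsBetween xs ys) ∎
  where
  open ≡-Reasoning
  arith : ∀ a b c d e → (a + b) + (c + d + e) ≡ a + c + d + (b + e)
  arith = solve-∀

inversions-map : ∀ {f : ℕ → ℕ} → f Preserves _<_ ⟶ _<_ →
  ∀ xs → inversions (map f xs) ≡ inversions xs
inversions-map f-mono []       = refl
inversions-map f-mono (x ∷ xs) = cong₂ _+_ (countBelow-map f-mono x xs) (inversions-map f-mono xs)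

inversionsBetween-↭ : ∀ {xs xs′ ys ys′} → xs ↭ xs′ → ys ↭ ys′ →
  inversionsBetween xs ys ≡ inversionsBetween xs′ ys′
inversionsBetween-↭ {xs} {xs′} {ys} {ys′} xs↭xs′ ys↭ys′ = begin
  sum (map (λ x → countBelow x ys) xs)
    ≡⟨ cong sum (map-cong (λ x → countBelow-↭ x ys↭ys′) xs) ⟩
  sum (map (λ x → countBelow x ys′) xs)
    ≡⟨ sum-↭ (map⁺ (λ x → countBelow x ys′) xs↭xs′) ⟩
  sum (map (λ x → countBelow x ys′) xs′) ∎
  where open ≡-Reasoning

inversionsBetween-map : ∀ {f : ℕ → ℕ} → f Preserves _<_ ⟶ _<_ → ∀ xs ys →
  inversionsBetween (map f xs) (map f ys) ≡ inversionsBetween xs ys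
inversionsBetween-map f-mono xs ys =
  cong sum (trans (sym (map-∘ xs)) (map-cong (λ x → countBelow-map f-mono x ys) xs))

inversionsBetween-++ˡ : ∀ xs xs′ ys →
  inversionsBetween (xs ++ xs′) ys ≡ inversionsBetween xs ys + inversionsBetween xs′ ys
inversionsBetween-++ˡ xs xs′ ys =
  trans (cong sum (map-++ count xs xs′)) (sum-++ (map count xs) (map count xs′))
  where
  count : ℕ → ℕ
  count x = countBelow x ys

inversionsBetween-++ʳ : ∀ xs ys zs →
  inversionsBetween xs (ys ++ zs) ≡ inversionsBetween xs ys + inversionsBetween xs zs
inversionsBetween-++ʳ []       ys zs = refl
inversionsBetween-++ʳ (x ∷ xs) ys zs =
  trans (cong₂ _+_ (countBelow-++ x ys zs) (inversionsBetween-++ʳ xs ys zs))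
        (arith (countBelow x ys) (countBelow x zs) (inversionsBetween xs ys) (inversionsBetween xs zs))
  where
  arith : ∀ a b c d → (a + b) + (c + d) ≡ (a + c) + (b + d)
  arith = solve-∀

inversionsBetween-< : ∀ {a xs ys} → All (_< a) xs → All (a ≤_) ys → inversionsBetween xs ys ≡ 0
inversionsBetween-< []           _    = refl
inversionsBetween-< (x<a ∷ xs<a) a≤ys =
  cong₂ _+_ (countBelow-≤ (All.map (λ a≤y → <⇒≤ (<-≤-trans x<a a≤y)) a≤ys))
            (inversionsBetween-< xs<a a≤ys)

inversionsBetween-> : ∀ {a xs ys} → All (a ≤_) xs → All (_< a) ys →
  inversionsBetween xs ys ≡ length xs * length ys
inversionsBetween-> []           _    = refl
inversionsBetween-> (a≤x ∷ a≤xs) ys<a =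
  cong₂ _+_ (countBelow-> (All.map (λ y<a → <-≤-trans y<a a≤x) ys<a)) (inversionsBetween-> a≤xs ys<a)

inversionsBetween-++-shift : ∀ {P xs ys} → All (_< P) xs → All (_< P) ys →
  inversionsBetween (xs ++ map (P +_) xs) (ys ++ map (P +_) ys)
    ≡ 2 * inversionsBetween xs ys + length xs * length ys
inversionsBetween-++-shift {P} {xs} {ys} xs<P ys<P = begin
  inversionsBetween (xs ++ P+xs) (ys ++ P+ys)
    ≡⟨ inversionsBetween-++ˡ xs P+xs (ys ++ P+ys) ⟩
  inversionsBetween xs (ys ++ P+ys) + inversionsBetween P+xs (ys ++ P+ys)
    ≡⟨ cong₂ _+_ (inversionsBetween-++ʳ xs ys P+ys) (inversionsBetween-++ʳ P+xs ys P+ys) ⟩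
  (inversionsBetween xs ys + inversionsBetween xs P+ys)
    + (inversionsBetween P+xs ys + inversionsBetween P+xs P+ys)
    ≡⟨ cong₂ _+_ (cong (inversionsBetween xs ys +_) (inversionsBetween-< xs<P (shifted ys)))
                 (cong₂ _+_ (inversionsBetween-> (shifted xs) ys<P)
                            (inversionsBetween-map (+-monoʳ-< P) xs ys)) ⟩
  (inversionsBetween xs ys + 0) + (length P+xs * length ys + inversionsBetween xs ys)
    ≡⟨ cong (λ k → (inversionsBetween xs ys + 0) + (k * length ys + inversionsBetween xs ys))
            (length-map (P +_) xs) ⟩
  (inversionsBetween xs ys + 0) + (length xs * length ys + inversionsBetween xs ys)
    ≡⟨ arith (inversionsBetween xs ys) (length xs * length ys) ⟩
  2 * inversionsBetween xs ys + length xs * length ys ∎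
  where
  open ≡-Reasoning
  P+xs P+ys : List ℕ
  P+xs = map (P +_) xs
  P+ys = map (P +_) ys
  shifted : ∀ zs → All (P ≤_) (map (P +_) zs)
  shifted zs = All-map⁺ (All.universal (m≤m+n P) zs)
  arith : ∀ x y → (x + 0) + (y + x) ≡ 2 * x + y
  arith = solve-∀

-- The two halves of the chips

crossCount : ℕ → ℕ → ℕ
crossCount N e = 2 ^ (N ∸ 1) * (2 ^ N ∸ 2 ^ e)

crossCount-suc : ∀ {e N} → e ≤ N → 2 * crossCount N e + 2 ^ N * 2 ^ N ≡ crossCount (suc N) e
crossCount-suc {N = zero}  z≤n = refl
crossCount-suc {e} {suc M} e≤N = begin
  2 * (a * d) + 2 * a * (2 * a)
    ≡⟨ arith a d ⟩
  2 * a * (2 * a + d)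
    ≡⟨ cong (2 * a *_) (sym (+-∸-assoc (2 * a) (^-monoʳ-≤ 2 e≤N))) ⟩
  2 * a * (2 * a + 2 * a ∸ 2 ^ e)
    ≡⟨ cong (λ k → 2 * a * (2 * a + k ∸ 2 ^ e)) (sym (+-identityʳ (2 * a))) ⟩
  crossCount (suc (suc M)) e ∎
  where
  open ≡-Reasoning
  a d : ℕ
  a = 2 ^ M
  d = 2 ^ suc M ∸ 2 ^ e
  arith : ∀ a d → 2 * (a * d) + 2 * a * (2 * a) ≡ 2 * a * (2 * a + d)
  arith = solve-∀

inversionsBetween-halves : ∀ {e N} → e ≤ N →
  inversionsBetween (map (insertBit false e) (upTo (2 ^ N))) (map (insertBit true e) (upTo (2 ^ N)))
    ≡ crossCount N e
inversionsBetween-halves {e} = go ∘ ≤⇒≤′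
  where
  open ≡-Reasoning
  half : Bool → ℕ → List ℕ
  half b N = map (insertBit b e) (upTo (2 ^ N))
  go : ∀ {N} → e ≤′ N → inversionsBetween (half false N) (half true N) ≡ crossCount N e
  go ≤′-refl = begin
    inversionsBetween (half false e) (half true e)
      ≡⟨ cong₂ inversionsBetween (map-id-local (All.map (insertBit-<2^ false e) (all-upTo (2 ^ e))))
                                 (map-cong-local (All.map (insertBit-true-<2^ e) (all-upTo (2 ^ e)))) ⟩
    inversionsBetween (upTo (2 ^ e)) (map (2 ^ e +_) (upTo (2 ^ e)))
      ≡⟨ inversionsBetween-< (all-upTo (2 ^ e))
                             (All-map⁺ (All.universal (m≤m+n (2 ^ e)) (upTo (2 ^ e)))) ⟩
    0
      ≡⟨ sym (trans (cong (2 ^ (e ∸ 1) *_) (n∸n≡0 (2 ^ e))) (*-zeroʳ (2 ^ (e ∸ 1)))) ⟩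
    crossCount e e ∎
  go (≤′-step {N} e≤′N) = begin
    inversionsBetween (half false (suc N)) (half true (suc N))
      ≡⟨ cong₂ inversionsBetween (map-insertBit-upTo-2^suc false e≤N)
                                 (map-insertBit-upTo-2^suc true e≤N) ⟩
    inversionsBetween (half false N ++ map (2 ^ suc N +_) (half false N))
                      (half true N ++ map (2 ^ suc N +_) (half true N))
      ≡⟨ inversionsBetween-++-shift (half<2^suc false) (half<2^suc true) ⟩
    2 * inversionsBetween (half false N) (half true N) + length (half false N) * length (half true N)
      ≡⟨ cong₂ (λ x y → 2 * x + y) (go e≤′N) (cong₂ _*_ (length-half false) (length-half true)) ⟩
    2 * crossCount N e + 2 ^ N * 2 ^ N
      ≡⟨ crossCount-suc e≤N ⟩
    crossCount (suc N) e ∎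
    where
    e≤N : e ≤ N
    e≤N = ≤′⇒≤ e≤′N
    half<2^suc : ∀ b → All (_< 2 ^ suc N) (half b N)
    half<2^suc b = All-map⁺ (All.map (insertBit<2^suc b e≤N) (all-upTo (2 ^ N)))
    length-half : ∀ b → length (half b N) ≡ 2 ^ N
    length-half b = trans (length-map (insertBit b e) (upTo (2 ^ N))) (length-upTo (2 ^ N))

-- One layer of firing

filterᵇ-not-++-filterᵇ-↭ : ∀ {A : Set} (p : A → Bool) xs →
  filterᵇ (not ∘ p) xs ++ filterᵇ p xs ↭ xs
filterᵇ-not-++-filterᵇ-↭ p []       = ↭-refl
filterᵇ-not-++-filterᵇ-↭ p (x ∷ xs) with p x
... | true  = ↭-trans (shift x (filterᵇ (not ∘ p) xs) (filterᵇ p xs))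
                      (prep x (filterᵇ-not-++-filterᵇ-↭ p xs))
... | false = prep x (filterᵇ-not-++-filterᵇ-↭ p xs)

fireDown-↭ : ∀ n ks cs → fireDown n ks cs ↭ cs
fireDown-↭ n []       cs = ↭-refl
fireDown-↭ n (k ∷ ks) cs =
  ↭-trans (++⁺ (fireDown-↭ n ks _) (fireDown-↭ n ks _)) (filterᵇ-not-++-filterᵇ-↭ (msbit n k) cs)

config-↭ : ∀ n w → config n w ↭ upTo (2 ^ n)
config-↭ n w = fireDown-↭ n (wSeq n w) (upTo (2 ^ n))

fireDown-map : ∀ {n n′} {g : Fin n′ → Fin n} {f : ℕ → ℕ} →
  (∀ k c → msbit n (g k) (f c) ≡ msbit n′ k c) →
  ∀ ks cs → fireDown n (map g ks) (map f cs) ≡ map f (fireDown n′ ks cs)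
fireDown-map h []       cs = refl
fireDown-map {n} {n′} {g} {f} h (k ∷ ks) cs = begin
  fireDown n (map g ks) (filterᵇ (not ∘ msbit n (g k)) (map f cs))
    ++ fireDown n (map g ks) (filterᵇ (msbit n (g k)) (map f cs))
    ≡⟨ cong₂ (λ xs ys → fireDown n (map g ks) xs ++ fireDown n (map g ks) ys)
             (filterᵇ-map-msbit (cong not ∘ h k)) (filterᵇ-map-msbit (h k)) ⟩
  fireDown n (map g ks) (map f left) ++ fireDown n (map g ks) (map f right)
    ≡⟨ cong₂ _++_ (fireDown-map h ks left) (fireDown-map h ks right) ⟩
  map f (fireDown n′ ks left) ++ map f (fireDown n′ ks right)
    ≡⟨ sym (map-++ f (fireDown n′ ks left) (fireDown n′ ks right)) ⟩
  map f (fireDown n′ (k ∷ ks) cs) ∎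
  where
  open ≡-Reasoning
  left right : List ℕ
  left  = filterᵇ (not ∘ msbit n′ k) cs
  right = filterᵇ (msbit n′ k) cs
  filterᵇ-map-msbit : ∀ {p q : ℕ → Bool} → p ∘ f ≗ q →
    filterᵇ p (map f cs) ≡ map f (filterᵇ q cs)
  filterᵇ-map-msbit {p} p∘f≗q = trans (filterᵇ-map p f cs) (cong (map f) (filterᵇ-cong p∘f≗q cs))

toℕ-punchIn : ∀ {N} (i : Fin (suc N)) (j : Fin N) →
    (toℕ j < toℕ i × toℕ (punchIn i j) ≡ toℕ j)
  ⊎ (toℕ i ≤ toℕ j × toℕ (punchIn i j) ≡ suc (toℕ j))
toℕ-punchIn fzero    j        = inj₂ (z≤n , refl)
toℕ-punchIn (fsuc i) fzero    = inj₁ (s≤s z≤n , refl)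
toℕ-punchIn (fsuc i) (fsuc j) with toℕ-punchIn i j
... | inj₁ (j<i , eq) = inj₁ (s≤s j<i , cong suc eq)
... | inj₂ (i≤j , eq) = inj₂ (s≤s i≤j , cong suc eq)

-- Once digit i (from the top) is inserted, punchIn i translates the digit positions of the
-- N-digit chips into those of the (N+1)-digit chips.
msbit-punchIn-insertBit : ∀ {N} b (i : Fin (suc N)) (j : Fin N) c →
  msbit (suc N) (punchIn i j) (insertBit b (N ∸ toℕ i) c) ≡ msbit N j c
msbit-punchIn-insertBit {N} b i j c with toℕ-punchIn i j
... | inj₁ (j<i , eq) = begin
  lsbit (N ∸ toℕ (punchIn i j)) (insertBit b e c)
    ≡⟨ cong (λ k → lsbit (N ∸ k) (insertBit b e c)) eq ⟩
  lsbit (N ∸ toℕ j) (insertBit b e c)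
    ≡⟨ cong (λ k → lsbit k (insertBit b e c)) (+-∸-assoc 1 (toℕ<n j)) ⟩
  lsbit (suc (N ∸ suc (toℕ j))) (insertBit b e c)
    ≡⟨ lsbit-insertBit-above b c (∸-monoʳ-≤ N j<i) ⟩
  lsbit (N ∸ suc (toℕ j)) c ∎
  where
  open ≡-Reasoning
  e : ℕ
  e = N ∸ toℕ i
... | inj₂ (i≤j , eq) = begin
  lsbit (N ∸ toℕ (punchIn i j)) (insertBit b e c)
    ≡⟨ cong (λ k → lsbit (N ∸ k) (insertBit b e c)) eq ⟩
  lsbit (N ∸ suc (toℕ j)) (insertBit b e c)
    ≡⟨ lsbit-insertBit-below b c (∸-monoʳ-< (s≤s i≤j) (toℕ<n j)) ⟩
  lsbit (N ∸ suc (toℕ j)) c ∎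
  where
  open ≡-Reasoning
  e : ℕ
  e = N ∸ toℕ i

wSeq-suc : ∀ N (w : Permutation′ (suc N)) →
  wSeq (suc N) w ≡ (w ⟨$⟩ʳ fzero) ∷ map (punchIn (w ⟨$⟩ʳ fzero)) (wSeq N (remove fzero w))
wSeq-suc N w = cong ((w ⟨$⟩ʳ fzero) ∷_) (begin
  map (w ⟨$⟩ʳ_) (tabulate fsuc)
    ≡⟨ map-tabulate fsuc (w ⟨$⟩ʳ_) ⟩
  tabulate (λ j → w ⟨$⟩ʳ fsuc j)
    ≡⟨ tabulate-cong (punchIn-permute w fzero) ⟩
  tabulate (punchIn i ∘ (w′ ⟨$⟩ʳ_))
    ≡⟨ sym (map-tabulate (w′ ⟨$⟩ʳ_) (punchIn i)) ⟩
  map (punchIn i) (tabulate (w′ ⟨$⟩ʳ_))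
    ≡⟨ cong (map (punchIn i)) (sym (map-tabulate id (w′ ⟨$⟩ʳ_))) ⟩
  map (punchIn i) (map (w′ ⟨$⟩ʳ_) (tabulate id)) ∎)
  where
  open ≡-Reasoning
  i : Fin (suc N)
  i = w ⟨$⟩ʳ fzero
  w′ : Permutation′ N
  w′ = remove fzero w

-- The position of the digit w₁ read at the root, counted from the least significant digit.
rootBit : ∀ N → Permutation′ (suc N) → ℕ
rootBit N w = N ∸ toℕ (w ⟨$⟩ʳ fzero)

rootBit≤ : ∀ N w → rootBit N w ≤ N
rootBit≤ N w = m∸n≤m N (toℕ (w ⟨$⟩ʳ fzero))

config-suc : ∀ N w → let e = rootBit N w; C = config N (remove fzero w) in
  config (suc N) w ≡ map (insertBit false e) C ++ map (insertBit true e) C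
config-suc N w = begin
  fireDown (suc N) (wSeq (suc N) w) (upTo (2 ^ suc N))
    ≡⟨ cong (λ ks → fireDown (suc N) ks (upTo (2 ^ suc N))) (wSeq-suc N w) ⟩
  fireDown (suc N) ks (filterᵇ (hasBit false e) (upTo (2 ^ suc N)))
    ++ fireDown (suc N) ks (filterᵇ (hasBit true e) (upTo (2 ^ suc N)))
    ≡⟨ cong₂ (λ xs ys → fireDown (suc N) ks xs ++ fireDown (suc N) ks ys)
             (filter-hasBit-upTo false (rootBit≤ N w)) (filter-hasBit-upTo true (rootBit≤ N w)) ⟩
  fireDown (suc N) ks (map (insertBit false e) L) ++ fireDown (suc N) ks (map (insertBit true e) L)
    ≡⟨ cong₂ _++_ (fireDown-map (msbit-punchIn-insertBit false i) (wSeq N w′) L)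
                  (fireDown-map (msbit-punchIn-insertBit true i) (wSeq N w′) L) ⟩
  map (insertBit false e) (config N w′) ++ map (insertBit true e) (config N w′) ∎
  where
  open ≡-Reasoning
  i : Fin (suc N)
  i = w ⟨$⟩ʳ fzero
  w′ : Permutation′ N
  w′ = remove fzero w
  e : ℕ
  e = rootBit N w
  L : List ℕ
  L = upTo (2 ^ N)
  ks : List (Fin (suc N))
  ks = map (punchIn i) (wSeq N w′)

I₂-suc : ∀ N w → I₂ (suc N) w ≡ 2 * I₂ N (remove fzero w) + crossCount N (rootBit N w)
I₂-suc N w = begin
  inversions (config (suc N) w)
    ≡⟨ cong inversions (config-suc N w) ⟩
  inversions (map f₀ C ++ map f₁ C)
    ≡⟨ inversions-++ (map f₀ C) (map f₁ C) ⟩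
  inversions (map f₀ C) + inversions (map f₁ C) + inversionsBetween (map f₀ C) (map f₁ C)
    ≡⟨ cong₂ _+_ (cong₂ _+_ (inversions-map (insertBit-mono-< false e) C)
                            (inversions-map (insertBit-mono-< true e) C))
                 (inversionsBetween-↭ (map⁺ f₀ (config-↭ N w′)) (map⁺ f₁ (config-↭ N w′))) ⟩
  inversions C + inversions C + inversionsBetween (map f₀ (upTo (2 ^ N))) (map f₁ (upTo (2 ^ N)))
    ≡⟨ cong₂ (λ k l → inversions C + k + l) (sym (+-identityʳ (inversions C)))
             (inversionsBetween-halves (rootBit≤ N w)) ⟩
  2 * inversions C + crossCount N e ∎
  where
  open ≡-Reasoning
  w′ : Permutation′ N
  w′ = remove fzero w
  e : ℕ
  e = rootBit N w
  f₀ f₁ : ℕ → ℕ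
  f₀ = insertBit false e
  f₁ = insertBit true e
  C : List ℕ
  C = config N w′

I₂-cong : ∀ n {w v : Permutation′ n} → w ≈ v → I₂ n w ≡ I₂ n v
I₂-cong n w≈v = cong (λ ks → inversions (fireDown n ks (upTo (2 ^ n)))) (map-cong w≈v (allFin n))

-- The attainable values

n<2^n : ∀ n → n < 2 ^ n
n<2^n zero    = s≤s z≤n
n<2^n (suc n) = subst (suc (suc n) ≤_) (sym (2^suc≡2^+2^ n)) (+-mono-≤ (m^n>0 2 n) (n<2^n n))

2^m+n≤2^n : ∀ {m n} → m < n → 2 ^ m + n ≤ 2 ^ n
2^m+n≤2^n {m} {suc n} (s≤s m≤n) with m≤n⇒m<n∨m≡n m≤n
... | inj₂ refl = begin
  2 ^ m + suc m ≤⟨ +-monoʳ-≤ (2 ^ m) (n<2^n m) ⟩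
  2 ^ m + 2 ^ m ≡⟨ sym (2^suc≡2^+2^ m) ⟩
  2 ^ suc m     ∎
  where open ≤-Reasoning
... | inj₁ m<n = begin
  2 ^ m + suc n   ≡⟨ +-suc (2 ^ m) n ⟩
  suc (2 ^ m + n) ≤⟨ s≤s (2^m+n≤2^n m<n) ⟩
  suc (2 ^ n)     ≡⟨ +-comm 1 (2 ^ n) ⟩
  2 ^ n + 1       ≤⟨ +-monoʳ-≤ (2 ^ n) (m^n>0 2 n) ⟩
  2 ^ n + 2 ^ n   ≡⟨ sym (2^suc≡2^+2^ n) ⟩
  2 ^ suc n       ∎
  where open ≤-Reasoning

discreteIVT : ∀ (s : ℕ → ℕ) {a L} k → (∀ i → i < k → s (suc i) ≤ s i + suc L) →
  s 0 ≤ a + L → a ≤ s k → ∃ λ i → i ≤ k × a ≤ s i × s i ≤ a + L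
discreteIVT s zero _ s₀≤a+L a≤s₀ = 0 , z≤n , a≤s₀ , s₀≤a+L
discreteIVT s {a} {L} (suc k) steps s₀≤a+L a≤sₖ₊₁ with s (suc k) ≤? a + L
... | yes sₖ₊₁≤a+L = suc k , ≤-refl , a≤sₖ₊₁ , sₖ₊₁≤a+L
... | no  sₖ₊₁≰a+L =
  let i , i≤k , a≤sᵢ , sᵢ≤a+L = discreteIVT s k (λ i → steps i ∘ m<n⇒m<1+n) s₀≤a+L a≤sₖ
  in  i , m≤n⇒m≤1+n i≤k , a≤sᵢ , sᵢ≤a+L
  where
  open ≤-Reasoning
  a≤sₖ : a ≤ s k
  a≤sₖ = +-cancelʳ-≤ (suc L) a (s k) (begin
    a + suc L   ≡⟨ +-suc a L ⟩
    suc (a + L) ≤⟨ ≰⇒> sₖ₊₁≰a+L ⟩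
    s (suc k)   ≤⟨ steps k ≤-refl ⟩
    s k + suc L ∎)

increment-decomposition : ∀ N m → m + suc (suc N) ≤ 2 ^ suc N →
  ∃ λ e → e ≤ N × ∃ λ m′ → m′ + suc N ≤ 2 ^ N × m ≡ m′ + (2 ^ N ∸ 2 ^ e)
increment-decomposition N m bound =
  let e , e≤N , 2^N≤m+2^e , m+2^e≤2^N+L =
        discreteIVT (λ e → m + 2 ^ e) N steps m+1≤2^N+L (m≤n+m (2 ^ N) m)
  in  e , e≤N , m + 2 ^ e ∸ 2 ^ N , remainder-bound {e} m+2^e≤2^N+L , split e≤N 2^N≤m+2^e
  where
  open ≤-Reasoning
  L : ℕ
  L = 2 ^ N ∸ suc N
  L+1+N≡2^N : L + suc N ≡ 2 ^ N
  L+1+N≡2^N = m∸n+n≡m (n<2^n N)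
  steps : ∀ e → e < N → m + 2 ^ suc e ≤ m + 2 ^ e + suc L
  steps e e<N = begin
    m + 2 ^ suc e       ≡⟨ cong (m +_) (2^suc≡2^+2^ e) ⟩
    m + (2 ^ e + 2 ^ e) ≡⟨ sym (+-assoc m (2 ^ e) (2 ^ e)) ⟩
    m + 2 ^ e + 2 ^ e   ≤⟨ +-monoʳ-≤ (m + 2 ^ e) (+-cancelʳ-≤ N (2 ^ e) (suc L) 2^e+N≤1+L+N) ⟩
    m + 2 ^ e + suc L   ∎
    where
    2^e+N≤1+L+N : 2 ^ e + N ≤ suc L + N
    2^e+N≤1+L+N = begin
      2 ^ e + N ≤⟨ 2^m+n≤2^n e<N ⟩
      2 ^ N     ≡⟨ sym L+1+N≡2^N ⟩
      L + suc N ≡⟨ +-suc L N ⟩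
      suc L + N ∎
  m+1≤2^N+L : m + 1 ≤ 2 ^ N + L
  m+1≤2^N+L = +-cancelʳ-≤ (suc N) (m + 1) (2 ^ N + L) (begin
    m + 1 + suc N       ≡⟨ +-assoc m 1 (suc N) ⟩
    m + suc (suc N)     ≤⟨ bound ⟩
    2 ^ suc N           ≡⟨ 2^suc≡2^+2^ N ⟩
    2 ^ N + 2 ^ N       ≡⟨ cong (2 ^ N +_) (sym L+1+N≡2^N) ⟩
    2 ^ N + (L + suc N) ≡⟨ sym (+-assoc (2 ^ N) L (suc N)) ⟩
    2 ^ N + L + suc N   ∎)
  remainder-bound : ∀ {e} → m + 2 ^ e ≤ 2 ^ N + L → m + 2 ^ e ∸ 2 ^ N + suc N ≤ 2 ^ N
  remainder-bound {e} m+2^e≤2^N+L = begin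
    m + 2 ^ e ∸ 2 ^ N + suc N ≤⟨ +-monoˡ-≤ (suc N) (∸-monoˡ-≤ (2 ^ N) m+2^e≤2^N+L) ⟩
    2 ^ N + L ∸ 2 ^ N + suc N ≡⟨ cong (_+ suc N) (m+n∸m≡n (2 ^ N) L) ⟩
    L + suc N                 ≡⟨ L+1+N≡2^N ⟩
    2 ^ N                     ∎
  split : ∀ {e} → e ≤ N → 2 ^ N ≤ m + 2 ^ e → m ≡ m + 2 ^ e ∸ 2 ^ N + (2 ^ N ∸ 2 ^ e)
  split {e} e≤N 2^N≤m+2^e = sym (begin-equality
    m + 2 ^ e ∸ 2 ^ N + (2 ^ N ∸ 2 ^ e)
      ≡⟨ sym (+-∸-assoc (m + 2 ^ e ∸ 2 ^ N) (^-monoʳ-≤ 2 e≤N)) ⟩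
    m + 2 ^ e ∸ 2 ^ N + 2 ^ N ∸ 2 ^ e
      ≡⟨ cong (_∸ 2 ^ e) (m∸n+n≡m 2^N≤m+2^e) ⟩
    m + 2 ^ e ∸ 2 ^ e
      ≡⟨ m+n∸n≡m m (2 ^ e) ⟩
    m ∎)

-- For n < 2 the exponent n ∸ 2 is truncated; this is harmless because the bound forces m = 0.
2*2^[n∸2]*m≡2^[n∸1]*m : ∀ n {m} → m + suc n ≤ 2 ^ n → 2 * (2 ^ (n ∸ 2) * m) ≡ 2 ^ (n ∸ 1) * m
2*2^[n∸2]*m≡2^[n∸1]*m zero          {m} bound rewrite n≤0⇒n≡0 (m+n≤o⇒m≤o∸n m bound) = refl
2*2^[n∸2]*m≡2^[n∸1]*m (suc zero)    {m} bound rewrite n≤0⇒n≡0 (m+n≤o⇒m≤o∸n m bound) = refl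
2*2^[n∸2]*m≡2^[n∸1]*m (suc (suc n)) {m} _     = sym (*-assoc 2 (2 ^ n) m)

I₂-suc-scaled : ∀ N w {m} → m + suc N ≤ 2 ^ N → I₂ N (remove fzero w) ≡ 2 ^ (N ∸ 2) * m →
  I₂ (suc N) w ≡ 2 ^ (suc N ∸ 2) * (m + (2 ^ N ∸ 2 ^ rootBit N w))
I₂-suc-scaled N w {m} bound I≡ = begin
  I₂ (suc N) w
    ≡⟨ I₂-suc N w ⟩
  2 * I₂ N (remove fzero w) + crossCount N e
    ≡⟨ cong (λ k → 2 * k + crossCount N e) I≡ ⟩
  2 * (2 ^ (N ∸ 2) * m) + crossCount N e
    ≡⟨ cong (_+ crossCount N e) (2*2^[n∸2]*m≡2^[n∸1]*m N bound) ⟩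
  2 ^ (N ∸ 1) * m + 2 ^ (N ∸ 1) * (2 ^ N ∸ 2 ^ e)
    ≡⟨ sym (*-distribˡ-+ (2 ^ (N ∸ 1)) m (2 ^ N ∸ 2 ^ e)) ⟩
  2 ^ (N ∸ 1) * (m + (2 ^ N ∸ 2 ^ e)) ∎
  where
  open ≡-Reasoning
  e : ℕ
  e = rootBit N w

I₂-values⊆ : ∀ n w → ∃ λ m → m + suc n ≤ 2 ^ n × I₂ n w ≡ 2 ^ (n ∸ 2) * m
I₂-values⊆ zero    w = 0 , ≤-refl , refl
I₂-values⊆ (suc N) w =
  let m , bound , I≡ = I₂-values⊆ N (remove fzero w)
  in  m + d , bound′ bound , I₂-suc-scaled N w bound I≡
  where
  open ≤-Reasoning
  d : ℕ
  d = 2 ^ N ∸ 2 ^ rootBit N w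
  d<2^N : d < 2 ^ N
  d<2^N = ∸-monoʳ-< (m^n>0 2 (rootBit N w)) (^-monoʳ-≤ 2 (rootBit≤ N w))
  bound′ : ∀ {m} → m + suc N ≤ 2 ^ N → m + d + suc (suc N) ≤ 2 ^ suc N
  bound′ {m} bound = begin
    m + d + suc (suc N) ≡⟨ arith m d N ⟩
    (m + suc N) + suc d ≤⟨ +-mono-≤ bound d<2^N ⟩
    2 ^ N + 2 ^ N       ≡⟨ sym (2^suc≡2^+2^ N) ⟩
    2 ^ suc N           ∎
    where
    arith : ∀ m d N → m + d + suc (suc N) ≡ (m + suc N) + suc d
    arith = solve-∀

I₂-values⊇ : ∀ n m → m + suc n ≤ 2 ^ n → ∃ λ w → I₂ n w ≡ 2 ^ (n ∸ 2) * m
I₂-values⊇ zero m bound rewrite n≤0⇒n≡0 (m+n≤o⇒m≤o∸n m bound) = idₚ , refl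
I₂-values⊇ (suc N) m bound with increment-decomposition N m bound
... | e , e≤N , m′ , m′-bound , refl with I₂-values⊇ N m′ m′-bound
... | w′ , I≡ = w , (begin
  I₂ (suc N) w
    ≡⟨ I₂-suc-scaled N w m′-bound I₂-w′ ⟩
  2 ^ (N ∸ 1) * (m′ + (2 ^ N ∸ 2 ^ rootBit N w))
    ≡⟨ cong (λ k → 2 ^ (N ∸ 1) * (m′ + (2 ^ N ∸ 2 ^ k))) rootBit-w ⟩
  2 ^ (N ∸ 1) * (m′ + (2 ^ N ∸ 2 ^ e)) ∎)
  where
  open ≡-Reasoning
  i : Fin (suc N)
  i = fromℕ< (s≤s (m∸n≤m N e))
  w : Permutation′ (suc N)
  w = insert fzero i w′
  I₂-w′ : I₂ N (remove fzero w) ≡ 2 ^ (N ∸ 2) * m′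
  I₂-w′ = trans (I₂-cong N {remove fzero w} {w′} (remove-insert fzero i w′)) I≡
  rootBit-w : rootBit N w ≡ e
  rootBit-w = trans (cong (N ∸_) (toℕ-fromℕ< (s≤s (m∸n≤m N e)))) (m∸[m∸n]≡n e≤N)

m≤2^n∸1∸n⇔m+1+n≤2^n : ∀ n m → m ≤ 2 ^ n ∸ 1 ∸ n ⇔ m + suc n ≤ 2 ^ n
m≤2^n∸1∸n⇔m+1+n≤2^n n m = mk⇔
  (λ m≤ → m≤o∸n⇒m+n≤o m (n<2^n n) (subst (m ≤_) (∸-+-assoc (2 ^ n) 1 n) m≤))
  (λ m+1+n≤ → subst (m ≤_) (sym (∸-+-assoc (2 ^ n) 1 n)) (m+n≤o⇒m≤o∸n m m+1+n≤))

proposition4p9 : (n k : ℕ) →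
    ((∃ λ (w : Permutation′ n) → I₂ n w ≡ k) → ∃ λ m → m ≤ 2 ^ n ∸ 1 ∸ n × k ≡ 2 ^ (n ∸ 2) * m)
    × ((∃ λ m → m ≤ 2 ^ n ∸ 1 ∸ n × k ≡ 2 ^ (n ∸ 2) * m) → ∃ λ (w : Permutation′ n) → I₂ n w ≡ k)
proposition4p9 n k =
    (λ { (w , refl) →
           let m , bound , I≡ = I₂-values⊆ n w
           in  m , from (m≤2^n∸1∸n⇔m+1+n≤2^n n m) bound , I≡ })
  , (λ { (m , m≤ , refl) → I₂-values⊇ n m (to (m≤2^n∸1∸n⇔m+1+n≤2^n n m) m≤) })
  where open Equivalence
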